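{- For every positive integer $n$, the formula $\mathrm{DLO}_n$ is $\left\lfloor \frac{n-3}{3}\right\rfloor$-extensible with respect to $\mathrm{WORDER}_n$.
   Context: $\mathrm{DLO}_n$ is the CNF in the variables $(x_{ij})_{i\ne j\in[n]}$ and $(z_{ikj})$ for distinct $i,k,j\in[n]$, consisting of: anti-symmetry $\neg x_{ij}\lor\neg x_{ji}$ for $i\neq j$; totality $x_{ij}\lor x_{ji}$ for $i\ne j$; transitivity $\neg x_{ij}\lor\neg x_{jk}\lor x_{ik}$ for distinct $i,j,k$; witness semantics $\neg z_{ikj}\lor x_{ik}$ and $\neg z_{ikj}\lor x_{kj}$ for distinct $i,j,k$; density $D_{ij} = \neg x_{ij}\lor\bigvee_{k\in[n]\setminus\{i,j\}} z_{ikj}$ for all $i\ne j$. $\mathrm{WORDER}_n$ is the set of all clauses of $\mathrm{DLO}_n$ other than the density clauses. A CNF is viewed as a linear CNF by writing $x$ as $(x=1)$ and $\neg x$ as $(x=0)$. For a linear CNF $\phi$ in variables $v$ and $F\subseteq\phi$, a solution of a linear system $Av=b$ over $\mathbb{F}_2$ is $F$-proper if it satisfies every clause of $F$; $\phi$ is $m$-extensible with respect to $F$ if for every linear system $Av=b$ over $\mathbb{F}_2$ in the variables $v$ with fewer than $m$ equations that has an $F$-proper solution, and every clause $C\in\phi\setminus F$, there is an $F$-proper solution of $Av=b$ satisfying $C$. -}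

module Defs where

open import Data.Nat using (ℕ; _<_; _∸_; _/_)
open import Data.Bool using (Bool; true; false; _xor_; _∧_; not)
open import Data.Fin using (Fin; _≟_)
open import Data.List using (List; []; _∷_; foldr; map; length; allFin; concatMap; filter)
open import Data.List.Relation.Unary.All using (All)
open import Data.List.Relation.Unary.Any using (Any)
open import Data.Product using (_×_; _,_; Σ; proj₁; proj₂)
open import Relation.Nullary using (¬_; Dec; yes; no)
open import Relation.Binary.PropositionalEquality using (_≡_; _≢_)
open import Relation.Nullary.Decidable using (¬?)
open import Relation.Nullary.Decidable using (_×-dec_)

-- Generic linear CNFs over F₂ = Bool (xor = addition, ∧ = product).

Lit : Set → Set
Lit V = V × Bool

Clause : Set → Set
Clause V = List (Lit V)

CNF : Set → Set₁
CNF V = Clause V → Set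

Assignment : Set → Set
Assignment V = V → Bool

_satisfies_ : {V : Set} → Assignment V → Clause V → Set
α satisfies C = Any (λ l → α (proj₁ l) ≡ proj₂ l) C

Proper : {V : Set} → CNF V → Assignment V → Set
Proper F α = ∀ C → F C → α satisfies C

record Equation (V : Set) : Set where
  constructor eqn
  field
    coeff : V → Bool
    rhs   : Bool

System : Set → Set
System V = List (Equation V)

lhs : {V : Set} → List V → Equation V → Assignment V → Bool
lhs vars e α = foldr (λ v acc → (Equation.coeff e v ∧ α v) xor acc) false vars

SolvesEq : {V : Set} → List V → Assignment V → Equation V → Set
SolvesEq vars α e = lhs vars e α ≡ Equation.rhs e

Solves : {V : Set} → List V → Assignment V → System V → Set
Solves vars α S = All (SolvesEq vars α) S

Extensible : {V : Set} → List V → CNF V → CNF V → ℕ → Set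
Extensible vars φ F m =
  (S : System _) → length S < m →
  Σ (Assignment _) (λ α → Proper F α × Solves vars α S) →
  (C : Clause _) → φ C → ¬ F C →
  Σ (Assignment _) (λ α → Proper F α × Solves vars α S × α satisfies C)

-- The variables of DLO_n.  Only the distinct-index ones are listed in
-- `dloVars n`, which is the variable set of the linear systems.

data Var (n : ℕ) : Set where
  x : Fin n → Fin n → Var n
  z : Fin n → Fin n → Fin n → Var n

dist₂? : {n : ℕ} → (p : Fin n × Fin n) → Dec (proj₁ p ≢ proj₂ p)
dist₂? (i , j) = ¬? (i ≟ j)

pairs : (n : ℕ) → List (Fin n × Fin n)
pairs n = filter dist₂? (concatMap (λ i → map (λ j → (i , j)) (allFin n)) (allFin n))

dist₃? : {n : ℕ} → (t : Fin n × Fin n × Fin n) →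
         Dec ((proj₁ t ≢ proj₁ (proj₂ t)) × (proj₁ t ≢ proj₂ (proj₂ t)) × (proj₁ (proj₂ t) ≢ proj₂ (proj₂ t)))
dist₃? (i , k , j) = ¬? (i ≟ k) ×-dec (¬? (i ≟ j) ×-dec ¬? (k ≟ j))

triples : (n : ℕ) → List (Fin n × Fin n × Fin n)
triples n = filter dist₃?
  (concatMap (λ i → concatMap (λ k → map (λ j → (i , k , j)) (allFin n)) (allFin n)) (allFin n))

dloVars : (n : ℕ) → List (Var n)
dloVars n = map (λ p → x (proj₁ p) (proj₂ p)) (pairs n)
  Data.List.++ map (λ t → z (proj₁ t) (proj₁ (proj₂ t)) (proj₂ (proj₂ t))) (triples n)

others : {n : ℕ} → Fin n → Fin n → List (Fin n)
others i j = filter (λ k → ¬? (k ≟ i) ×-dec ¬? (k ≟ j)) (allFin _)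

density : {n : ℕ} → Fin n → Fin n → Clause (Var n)
density i j = (x i j , false) ∷ map (λ k → (z i k j , true)) (others i j)

data WORDER (n : ℕ) : CNF (Var n) where
  antisym : (i j : Fin n) → i ≢ j →
    WORDER n ((x i j , false) ∷ (x j i , false) ∷ [])
  total : (i j : Fin n) → i ≢ j →
    WORDER n ((x i j , true) ∷ (x j i , true) ∷ [])
  trans : (i j k : Fin n) → i ≢ j → i ≢ k → j ≢ k →
    WORDER n ((x i j , false) ∷ (x j k , false) ∷ (x i k , true) ∷ [])
  wit₁ : (i k j : Fin n) → i ≢ k → i ≢ j → k ≢ j →
    WORDER n ((z i k j , false) ∷ (x i k , true) ∷ [])
  wit₂ : (i k j : Fin n) → i ≢ k → i ≢ j → k ≢ j →
    WORDER n ((z i k j , false) ∷ (x k j , true) ∷ [])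

data DLO (n : ℕ) : CNF (Var n) where
  worder  : ∀ {C} → WORDER n C → DLO n C
  dens    : (i j : Fin n) → i ≢ j → DLO n (density i j)

module Submission where

-- Let α be a WORDER-proper solution of S; if α(x_ij) = 0 it already satisfies D_ij, so assume i < j.
-- Call a point k free if it is neither i, nor j, nor a corner of a true witness z_abc. Moving a free
-- point into the interval (i, j) and switching on z_ikj, or switching off a true witness z_τ, changes
-- α by a fixed vector d_k resp. d_τ, and every sum α + Σ σ_g d_g over these generators is again proper:
-- the moves keep x a linear order, a switched-on z_ikj is witnessed because k now lies between i and j,
-- and every other true witness has unmoved corners. With a true witnesses there are at least
-- n − 2 − 3a free points, hence at least ⌊(n − 3)/3⌋ generators, more than the equations of S, so the
-- homogeneous system A (Σ σ_g d_g) = 0 has a nonzero solution σ. If σ moves some point k, then z_ikj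
-- satisfies D_ij; otherwise σ only switches witnesses off, and we recurse on the number of true witnesses.

open import Defs hiding (trans)

open import Algebra.Bundles using (CommutativeRing; CommutativeMonoid)
open import Data.Bool using (Bool; true; false; not; _∧_; _xor_; if_then_else_; T)
open import Data.Bool.Properties
  using (xor-∧-commutativeRing; xor-same; xor-comm; xor-identityʳ; not-distribˡ-xor; ¬-not;
         ∧-distribˡ-xor; ∧-zeroʳ; ∧-comm; ∧-assoc; ∧-identityʳ)
  renaming (_≟_ to _≟ᴮ_)
open import Data.Empty using (⊥-elim)
open import Data.Fin using (Fin; _≟_)
open import Data.Fin.Properties using (any?)
open import Data.List using (List; []; _∷_; _++_; foldr; map; length; filter; concatMap; allFin; cartesianProduct)
open import Data.List.Membership.Propositional using (_∈_; _∉_; lose)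
open import Data.List.Membership.Propositional.Properties
  using (∈-∃++; ∈-++⁻; ∈-++⁺ˡ; ∈-++⁺ʳ; ∈-map⁺; ∈-map⁻; ∈-filter⁺; ∈-filter⁻; ∈-concat⁺′; ∈-allFin; ∈-cartesianProduct⁺)
open import Data.List.Properties using (length-map; length-++; length-++-sucʳ; length-tabulate; filter-notAll)
open import Data.List.Relation.Binary.Permutation.Propositional using (_↭_; ↭-refl; ↭-prep; ↭-swap; ↭-trans; ↭-sym)
open import Data.List.Relation.Binary.Permutation.Propositional.Properties using (All-resp-↭; ↭-length)
open import Data.List.Relation.Binary.Subset.Propositional using (_⊆_)
open import Data.List.Relation.Unary.All as All using (All; []; _∷_)
open import Data.List.Relation.Unary.All.Properties using (map⁻)
open import Data.List.Relation.Unary.AllPairs using (_∷_)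
open import Data.List.Relation.Unary.Any using (here; there)
import Data.List.Relation.Unary.Any.Properties as Any
open import Data.List.Relation.Unary.Unique.Propositional using (Unique)
open import Data.List.Relation.Unary.Unique.Propositional.Properties using (++⁺; map⁺; filter⁺; allFin⁺; cartesianProduct⁺)
open import Data.Nat using (ℕ; suc; _≤_; _<_; _+_; _*_; _∸_; _/_; _<ᵇ_; z≤n; s≤s; s<s⁻¹)
open import Data.Nat.DivMod using (/-monoˡ-≤; m*n/n≡m)
open import Data.Nat.Induction using (<-wellFounded)
open import Data.Nat.Properties using (+-suc; +-comm; +-mono-≤; +-monoˡ-≤; m≤m*n; n≤1+n; m≤n+o⇒m∸n≤o; <-≤-trans; module ≤-Reasoning)
open import Data.Nat.Tactic.RingSolver using (solve-∀)
open import Data.Product using (∃-syntax; ∃₂; _×_; _,_; proj₁; proj₂)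
open import Data.Product.Properties using () renaming (≡-dec to ≡-dec×)
open import Data.Sum using (_⊎_; inj₁; inj₂)
open import Data.Sum.Properties using (inj₁-injective; inj₂-injective) renaming (≡-dec to ≡-dec⊎)
open import Function using (id)
open import Induction.WellFounded using (Acc; acc)
open import Level using (0ℓ)
open import Relation.Binary.Definitions using (DecidableEquality)
open import Relation.Binary.PropositionalEquality
  using (_≡_; _≢_; refl; sym; trans; cong; cong₂; subst; subst₂; ≢-sym; module ≡-Reasoning)
open import Relation.Nullary using (Dec; yes; no; does; ¬_; ¬?; contradiction)
open import Relation.Nullary.Decidable using (T?; _×-dec_; _→-dec_; map′; toWitness; dec-true; dec-false)
open import Relation.Unary using (Pred; Decidable)
open import Relation.Unary.Properties using (∁?)
open import Algebra.Properties.CommutativeSemigroup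
  (CommutativeMonoid.commutativeSemigroup (CommutativeRing.+-commutativeMonoid xor-∧-commutativeRing))
  using (interchange)

-- Sums over F₂

-- A right fold, so that lhs vars e α is definitionally xsum vars (λ v → coeff e v ∧ α v).
xsum : {A : Set} → List A → (A → Bool) → Bool
xsum as f = foldr (λ a s → f a xor s) false as

∧-exchange : ∀ a b c → a ∧ (b ∧ c) ≡ b ∧ (a ∧ c)
∧-exchange a b c = trans (sym (∧-assoc a b c)) (trans (cong (_∧ c) (∧-comm a b)) (∧-assoc b a c))

module _ {A : Set} where

  xsum-cong : (as : List A) {f g : A → Bool} → (∀ {a} → a ∈ as → f a ≡ g a) → xsum as f ≡ xsum as g
  xsum-cong []       eq = refl
  xsum-cong (a ∷ as) eq = cong₂ _xor_ (eq (here refl)) (xsum-cong as (λ a∈ → eq (there a∈)))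

  xsum-false : (as : List A) {f : A → Bool} → (∀ {a} → a ∈ as → f a ≡ false) → xsum as f ≡ false
  xsum-false []       eq = refl
  xsum-false (a ∷ as) eq rewrite eq (here refl) = xsum-false as (λ a∈ → eq (there a∈))

  xsum-xor : (as : List A) (f g : A → Bool) → xsum as (λ a → f a xor g a) ≡ xsum as f xor xsum as g
  xsum-xor []       f g = refl
  xsum-xor (a ∷ as) f g = trans (cong ((f a xor g a) xor_) (xsum-xor as f g)) (interchange (f a) (g a) _ _)

  xsum-∧ : (as : List A) (c : Bool) (f : A → Bool) → xsum as (λ a → c ∧ f a) ≡ c ∧ xsum as f
  xsum-∧ []       c f = sym (∧-zeroʳ c)
  xsum-∧ (a ∷ as) c f = trans (cong ((c ∧ f a) xor_) (xsum-∧ as c f)) (sym (∧-distribˡ-xor c (f a) _))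

  xsum-single : (as : List A) → Unique as → {p : A} → p ∈ as → {f : A → Bool} →
                (∀ {a} → a ≢ p → f a ≡ false) → xsum as f ≡ f p
  xsum-single (a ∷ as) (a∉ ∷ _) (here refl) {f} off =
    trans (cong (f a xor_) (xsum-false as (λ b∈ → off (λ { refl → All.lookup a∉ b∈ refl })))) (xor-identityʳ (f a))
  xsum-single (a ∷ as) (a∉ ∷ u) (there p∈) {f} off =
    trans (cong (_xor xsum as f) (off (λ { refl → All.lookup a∉ p∈ refl }))) (xsum-single as u p∈ off)

module _ {A B : Set} where

  xsum-swap : (as : List A) (bs : List B) (h : A → B → Bool) →
              xsum as (λ a → xsum bs (h a)) ≡ xsum bs (λ b → xsum as (λ a → h a b))
  xsum-swap []       bs h = sym (xsum-false bs (λ _ → refl))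
  xsum-swap (a ∷ as) bs h = trans (cong (xsum bs (h a) xor_) (xsum-swap as bs h))
                                  (sym (xsum-xor bs (h a) (λ b → xsum as (λ a′ → h a′ b))))

  xsum-bilinear : (as : List A) (bs : List B) (c : A → Bool) (σ : B → Bool) (d : B → A → Bool) →
    xsum as (λ a → c a ∧ xsum bs (λ b → σ b ∧ d b a)) ≡ xsum bs (λ b → σ b ∧ xsum as (λ a → c a ∧ d b a))
  xsum-bilinear as bs c σ d = begin
    xsum as (λ a → c a ∧ xsum bs (λ b → σ b ∧ d b a))   ≡⟨ xsum-cong as (λ {a} _ → sym (xsum-∧ bs (c a) _)) ⟩
    xsum as (λ a → xsum bs (λ b → c a ∧ (σ b ∧ d b a))) ≡⟨ xsum-swap as bs (λ a b → c a ∧ (σ b ∧ d b a)) ⟩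
    xsum bs (λ b → xsum as (λ a → c a ∧ (σ b ∧ d b a))) ≡⟨ xsum-cong bs (λ {b} _ → xsum-cong as (λ {a} _ → ∧-exchange (c a) (σ b) (d b a))) ⟩
    xsum bs (λ b → xsum as (λ a → σ b ∧ (c a ∧ d b a))) ≡⟨ xsum-cong bs (λ {b} _ → xsum-∧ as (σ b) _) ⟩
    xsum bs (λ b → σ b ∧ xsum as (λ a → c a ∧ d b a))   ∎
    where open ≡-Reasoning

lhs-shift : {V G : Set} (vars : List V) (e : Equation V) (α : Assignment V) (gs : List G)
            (σ : G → Bool) (d : G → Assignment V) →
            lhs vars e (λ v → α v xor xsum gs (λ g → σ g ∧ d g v))
              ≡ lhs vars e α xor xsum gs (λ g → σ g ∧ lhs vars e (d g))
lhs-shift vars e α gs σ d = begin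
  xsum vars (λ v → c v ∧ (α v xor xsum gs (λ g → σ g ∧ d g v)))
    ≡⟨ xsum-cong vars (λ {v} _ → ∧-distribˡ-xor (c v) (α v) _) ⟩
  xsum vars (λ v → (c v ∧ α v) xor (c v ∧ xsum gs (λ g → σ g ∧ d g v)))
    ≡⟨ xsum-xor vars (λ v → c v ∧ α v) _ ⟩
  lhs vars e α xor xsum vars (λ v → c v ∧ xsum gs (λ g → σ g ∧ d g v))
    ≡⟨ cong (lhs vars e α xor_) (xsum-bilinear vars gs c σ d) ⟩
  lhs vars e α xor xsum gs (λ g → σ g ∧ lhs vars e (d g))
    ∎
  where
    open ≡-Reasoning
    c = Equation.coeff e

-- Homogeneous systems over F₂

dot : {I : Set} → List I → (I → Bool) → (I → Bool) → Bool
dot gs σ ρ = xsum gs (λ g → σ g ∧ ρ g)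

eliminate : {I : Set} → I → (I → Bool) → (I → Bool) → I → Bool
eliminate g π ρ h = ρ h xor (ρ g ∧ π h)

dot-eliminate : {I : Set} (gs : List I) (σ π ρ : I → Bool) (g : I) →
                dot gs σ (eliminate g π ρ) ≡ dot gs σ ρ xor (ρ g ∧ dot gs σ π)
dot-eliminate gs σ π ρ g = begin
  xsum gs (λ h → σ h ∧ (ρ h xor (ρ g ∧ π h)))           ≡⟨ xsum-cong gs (λ {h} _ → ∧-distribˡ-xor (σ h) (ρ h) _) ⟩
  xsum gs (λ h → (σ h ∧ ρ h) xor (σ h ∧ (ρ g ∧ π h)))   ≡⟨ xsum-xor gs (λ h → σ h ∧ ρ h) (λ h → σ h ∧ (ρ g ∧ π h)) ⟩
  dot gs σ ρ xor xsum gs (λ h → σ h ∧ (ρ g ∧ π h))      ≡⟨ cong (dot gs σ ρ xor_) (xsum-cong gs (λ {h} _ → ∧-exchange (σ h) (ρ g) (π h))) ⟩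
  dot gs σ ρ xor xsum gs (λ h → ρ g ∧ (σ h ∧ π h))      ≡⟨ cong (dot gs σ ρ xor_) (xsum-∧ gs (ρ g) _) ⟩
  dot gs σ ρ xor (ρ g ∧ dot gs σ π)                     ∎
  where open ≡-Reasoning

module Coordinates {I : Set} (_≟_ : DecidableEquality I) where

  _≡ᵇ_ : I → I → Bool
  g ≡ᵇ h = does (g ≟ h)

  ≡ᵇ-refl : (g : I) → g ≡ᵇ g ≡ true
  ≡ᵇ-refl g = dec-true (g ≟ g) refl

  ≡ᵇ-≢ : {g h : I} → g ≢ h → g ≡ᵇ h ≡ false
  ≡ᵇ-≢ {g} {h} = dec-false (g ≟ h)

  _[_≔_] : (I → Bool) → I → Bool → I → Bool
  (σ [ g ≔ s ]) h = if h ≡ᵇ g then s else σ h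

  update-≡ : (σ : I → Bool) (g : I) (s : Bool) → (σ [ g ≔ s ]) g ≡ s
  update-≡ σ g s rewrite ≡ᵇ-refl g = refl

  update-≢ : (σ : I → Bool) {g h : I} (s : Bool) → h ≢ g → (σ [ g ≔ s ]) h ≡ σ h
  update-≢ σ s h≢g rewrite ≡ᵇ-≢ h≢g = refl

  module _ (gs : List I) (u : Unique gs) {σ : I → Bool} (support : ∀ {g} → σ g ≡ true → g ∈ gs) where

    xsum-point : {δ : I → Bool} (g₀ : I) → (∀ {g} → g ≢ g₀ → δ g ≡ false) →
                 xsum gs (λ g → σ g ∧ δ g) ≡ σ g₀ ∧ δ g₀
    xsum-point {δ} g₀ off with σ g₀ in σg₀
    ... | true  = trans (xsum-single gs u (support σg₀) (λ g≢g₀ → trans (cong (σ _ ∧_) (off g≢g₀)) (∧-zeroʳ _)))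
                        (cong (_∧ δ g₀) σg₀)
    ... | false = xsum-false gs vanish
      where
        vanish : ∀ {g} → g ∈ gs → σ g ∧ δ g ≡ false
        vanish {g} _ with g ≟ g₀
        ... | yes refl = cong (_∧ δ g) σg₀
        ... | no g≢g₀  = trans (cong (σ g ∧_) (off g≢g₀)) (∧-zeroʳ _)

    xsum-two-points : {δ₁ δ₂ : I → Bool} (g₁ g₂ : I) →
                      (∀ {g} → g ≢ g₁ → δ₁ g ≡ false) → (∀ {g} → g ≢ g₂ → δ₂ g ≡ false) →
                      xsum gs (λ g → σ g ∧ (δ₁ g xor δ₂ g)) ≡ (σ g₁ ∧ δ₁ g₁) xor (σ g₂ ∧ δ₂ g₂)
    xsum-two-points {δ₁} {δ₂} g₁ g₂ off₁ off₂ = begin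
      xsum gs (λ g → σ g ∧ (δ₁ g xor δ₂ g))                     ≡⟨ xsum-cong gs (λ {g} _ → ∧-distribˡ-xor (σ g) (δ₁ g) (δ₂ g)) ⟩
      xsum gs (λ g → (σ g ∧ δ₁ g) xor (σ g ∧ δ₂ g))             ≡⟨ xsum-xor gs (λ g → σ g ∧ δ₁ g) (λ g → σ g ∧ δ₂ g) ⟩
      xsum gs (λ g → σ g ∧ δ₁ g) xor xsum gs (λ g → σ g ∧ δ₂ g) ≡⟨ cong₂ _xor_ (xsum-point g₁ off₁) (xsum-point g₂ off₂) ⟩
      (σ g₁ ∧ δ₁ g₁) xor (σ g₂ ∧ δ₂ g₂)                         ∎
      where open ≡-Reasoning

  find-pivot : (g : I) (rows : List (I → Bool)) →
               All (λ ρ → ρ g ≡ false) rows ⊎ ∃₂ λ π rest → π g ≡ true × rows ↭ π ∷ rest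
  find-pivot g [] = inj₁ []
  find-pivot g (ρ ∷ rows) with ρ g in ρg
  ... | true  = inj₂ (ρ , rows , ρg , ↭-refl)
  ... | false with find-pivot g rows
  ...   | inj₁ zeros                   = inj₁ (ρg ∷ zeros)
  ...   | inj₂ (π , rest , πg , rows↭) = inj₂ (π , ρ ∷ rest , πg , ↭-trans (↭-prep ρ rows↭) (↭-swap ρ π ↭-refl))

  NontrivialSolution : List I → List (I → Bool) → Set
  NontrivialSolution gs rows =
    ∃[ σ ] (∀ {g} → σ g ≡ true → g ∈ gs) × (∃[ g ] σ g ≡ true) × All (λ ρ → dot gs σ ρ ≡ false) rows

  nontrivial-solution : (gs : List I) → Unique gs → (rows : List (I → Bool)) → length rows < length gs →
                        NontrivialSolution gs rows
  nontrivial-solution (g ∷ gs) (g∉ ∷ u) rows len with find-pivot g rows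
  ... | inj₁ zeros = (_≡ᵇ g) , support , (g , ≡ᵇ-refl g) , All.map orthogonal zeros
    where
      support : ∀ {h} → h ≡ᵇ g ≡ true → h ∈ g ∷ gs
      support {h} h≡g with h ≟ g
      ... | yes refl = here refl
      orthogonal : ∀ {ρ} → ρ g ≡ false → dot (g ∷ gs) (_≡ᵇ g) ρ ≡ false
      orthogonal {ρ} ρg rewrite ρg | ∧-zeroʳ (g ≡ᵇ g) =
        xsum-false gs {λ h → h ≡ᵇ g ∧ ρ h} (λ h∈ → cong (_∧ ρ _) (≡ᵇ-≢ (λ { refl → All.lookup g∉ h∈ refl })))
  ... | inj₂ (π , rest , πg , rows↭)
    with σ′ , support′ , (g′ , σ′g′) , orthogonal′ ←
         nontrivial-solution gs u (map (eliminate g π) rest)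
           (subst (_< length gs) (sym (length-map (eliminate g π) rest))
                  (s<s⁻¹ (subst (_< suc (length gs)) (↭-length rows↭) len)))
    = σ , support , (g′ , trans (update-≢ σ′ s (≢g (support′ σ′g′))) σ′g′) ,
      All-resp-↭ (↭-sym rows↭) (orthogonal-π ∷ All.map orthogonal (map⁻ orthogonal′))
    where
      s : Bool
      s = dot gs σ′ π
      σ : I → Bool
      σ = σ′ [ g ≔ s ]
      ≢g : ∀ {h} → h ∈ gs → h ≢ g
      ≢g h∈ refl = All.lookup g∉ h∈ refl
      support : ∀ {h} → σ h ≡ true → h ∈ g ∷ gs
      support {h} σh with h ≟ g
      ... | yes refl = here refl
      ... | no h≢g   = there (support′ σh)
      on-gs : ∀ ρ → dot gs σ ρ ≡ dot gs σ′ ρ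
      on-gs ρ = xsum-cong gs (λ h∈ → cong (_∧ _) (update-≢ σ′ s (≢g h∈)))
      orthogonal-π : dot (g ∷ gs) σ π ≡ false
      orthogonal-π = begin
        σ g ∧ π g xor dot gs σ π  ≡⟨ cong₂ (λ a b → a ∧ π g xor b) (update-≡ σ′ g s) (on-gs π) ⟩
        s ∧ π g xor s             ≡⟨ cong (λ b → s ∧ b xor s) πg ⟩
        s ∧ true xor s            ≡⟨ cong (_xor s) (∧-identityʳ s) ⟩
        s xor s                   ≡⟨ xor-same s ⟩
        false                     ∎
        where open ≡-Reasoning
      orthogonal : ∀ {ρ} → dot gs σ′ (eliminate g π ρ) ≡ false → dot (g ∷ gs) σ ρ ≡ false
      orthogonal {ρ} reduced = begin
        σ g ∧ ρ g xor dot gs σ ρ     ≡⟨ cong₂ (λ a b → a ∧ ρ g xor b) (update-≡ σ′ g s) (on-gs ρ) ⟩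
        s ∧ ρ g xor dot gs σ′ ρ      ≡⟨ cong (_xor dot gs σ′ ρ) (∧-comm s (ρ g)) ⟩
        ρ g ∧ s xor dot gs σ′ ρ      ≡⟨ xor-comm (ρ g ∧ s) _ ⟩
        dot gs σ′ ρ xor ρ g ∧ s      ≡⟨ dot-eliminate gs σ′ π ρ g ⟨
        dot gs σ′ (eliminate g π ρ)  ≡⟨ reduced ⟩
        false                        ∎
        where open ≡-Reasoning

module _ {A : Set} where

  unique-⊆⇒length≤ : {xs ys : List A} → Unique xs → xs ⊆ ys → length xs ≤ length ys
  unique-⊆⇒length≤ {[]}     _          _     = z≤n
  unique-⊆⇒length≤ {a ∷ xs} (a∉ ∷ u) xs⊆ys with us , vs , refl ← ∈-∃++ (xs⊆ys (here refl)) =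
    subst (_ ≤_) (sym (length-++-sucʳ us a vs)) (s≤s (unique-⊆⇒length≤ u xs⊆us++vs))
    where
      xs⊆us++vs : xs ⊆ us ++ vs
      xs⊆us++vs y∈ with ∈-++⁻ us (xs⊆ys (there y∈))
      ... | inj₁ y∈us         = ∈-++⁺ˡ y∈us
      ... | inj₂ (here refl)  = ⊥-elim (All.lookup a∉ y∈ refl)
      ... | inj₂ (there y∈vs) = ∈-++⁺ʳ us y∈vs

  length-filter-∁ : {P : Pred A 0ℓ} (P? : Decidable P) (xs : List A) →
                    length xs ≡ length (filter P? xs) + length (filter (∁? P?) xs)
  length-filter-∁ P? [] = refl
  length-filter-∁ P? (a ∷ xs) with does (P? a)
  ... | true  = cong suc (length-filter-∁ P? xs)
  ... | false = trans (cong suc (length-filter-∁ P? xs)) (sym (+-suc _ _))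

module _ {A : Set} (_≟_ : DecidableEquality A) where
  open import Data.List.Membership.DecPropositional _≟_ using (_∈?_; _∉?_)

  length≤filter-∉+length : (L : List A) {xs : List A} → Unique xs → length xs ≤ length (filter (_∉? L) xs) + length L
  length≤filter-∉+length L {xs} u = begin
    length xs                                                         ≡⟨ length-filter-∁ (_∈? L) xs ⟩
    length (filter (_∈? L) xs) + length (filter (_∉? L) xs)          ≤⟨ +-monoˡ-≤ _ (unique-⊆⇒length≤ (filter⁺ (_∈? L) u) (λ y∈ → proj₂ (∈-filter⁻ (_∈? L) {xs = xs} y∈))) ⟩
    length L + length (filter (_∉? L) xs)                             ≡⟨ +-comm (length L) _ ⟩
    length (filter (_∉? L) xs) + length L                             ∎
    where open ≤-Reasoning

module _ {A : Set} {P Q : Pred A 0ℓ} (P? : Decidable P) (Q? : Decidable Q) (P⇒Q : ∀ {a} → P a → Q a) where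

  filter-absorb : (xs : List A) → filter P? (filter Q? xs) ≡ filter P? xs
  filter-absorb [] = refl
  filter-absorb (a ∷ xs) with Q? a
  ... | yes _ with P? a
  ...   | yes _ = cong (a ∷_) (filter-absorb xs)
  ...   | no _  = filter-absorb xs
  filter-absorb (a ∷ xs) | no ¬qa with P? a
  ...   | yes pa = contradiction (P⇒Q pa) ¬qa
  ...   | no _   = filter-absorb xs

  length-filter-< : {a : A} (xs : List A) → a ∈ xs → Q a → ¬ P a → length (filter P? xs) < length (filter Q? xs)
  length-filter-< xs a∈ qa ¬pa =
    subst (_< length (filter Q? xs)) (cong length (filter-absorb xs)) (filter-notAll P? (filter Q? xs) (lose (∈-filter⁺ Q? a∈ qa) ¬pa))

third-bound : ∀ N c a → N ≤ c + (2 + a * 3) → (N ∸ 3) / 3 ≤ c + a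
third-bound N c a N≤ = begin
  (N ∸ 3) / 3      ≤⟨ /-monoˡ-≤ 3 (m≤n+o⇒m∸n≤o N 3 N≤3+[c+a]*3) ⟩
  (c + a) * 3 / 3  ≡⟨ m*n/n≡m (c + a) 3 ⟩
  c + a            ∎
  where
    open ≤-Reasoning
    regroup : ∀ c a → c * 3 + (3 + a * 3) ≡ 3 + (c + a) * 3
    regroup = solve-∀
    N≤3+[c+a]*3 : N ≤ 3 + (c + a) * 3
    N≤3+[c+a]*3 = begin
      N                    ≤⟨ N≤ ⟩
      c + (2 + a * 3)      ≤⟨ +-mono-≤ (m≤m*n c 3) (n≤1+n (2 + a * 3)) ⟩
      c * 3 + (3 + a * 3)  ≡⟨ regroup c a ⟩
      3 + (c + a) * 3      ∎

-- Positions relative to i < j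

data Region : Set where
  before-i at-i between at-j after-j : Region

index : Region → ℕ
index before-i = 0
index at-i     = 1
index between  = 2
index at-j     = 3
index after-j  = 4

_≺_ : Region → Region → Set
r ≺ s = T (index r <ᵇ index s)

endpoint : Region → Bool
endpoint at-i = true
endpoint at-j = true
endpoint _    = false

-- A moving point is placed just after i if it lies before i, and just before j if it lies after j.
-- crosses r s a: whether p, of region r, passes q, of region s, when p moves, given a = x_pq;
-- reorder r s a t u: the new value of x_pq, where t and u tell whether p and q move.
crosses : Region → Region → Bool → Bool
crosses before-i at-i     _ = true
crosses before-i before-i a = a
crosses after-j  at-j     _ = true
crosses after-j  after-j  a = not a
crosses _        _        _ = false

reorder : Region → Region → Bool → Bool → Bool → Bool
reorder r s a t u = a xor ((t ∧ crosses r s a) xor (u ∧ crosses s r (not a)))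

Consistent : Region → Region → Bool → Set
Consistent r s a = (r ≺ s → a ≡ true) × (s ≺ r → a ≡ false)

TransitiveTriple : Bool → Bool → Bool → Set
TransitiveTriple a b c = (a ≡ true → b ≡ true → c ≡ true) × (a ≡ false → b ≡ false → c ≡ false)

Movable : Region → Bool → Set
Movable r t = t ≡ true → endpoint r ≡ false

∀-Bool? : {P : Bool → Set} → (∀ b → Dec (P b)) → Dec (∀ b → P b)
∀-Bool? P? = map′ (λ { (t , f) → λ { true → t ; false → f } }) (λ p → p true , p false) (P? true ×-dec P? false)

∀-Region? : {P : Region → Set} → (∀ r → Dec (P r)) → Dec (∀ r → P r)
∀-Region? P? =
  map′ (λ { (p₁ , p₂ , p₃ , p₄ , p₅) → λ { before-i → p₁ ; at-i → p₂ ; between → p₃ ; at-j → p₄ ; after-j → p₅ } })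
       (λ p → p before-i , p at-i , p between , p at-j , p after-j)
       (P? before-i ×-dec P? at-i ×-dec P? between ×-dec P? at-j ×-dec P? after-j)

consistent? : ∀ r s a → Dec (Consistent r s a)
consistent? r s a = (T? _ →-dec a ≟ᴮ true) ×-dec (T? _ →-dec a ≟ᴮ false)

transitive-triple? : ∀ a b c → Dec (TransitiveTriple a b c)
transitive-triple? a b c = (a ≟ᴮ true →-dec b ≟ᴮ true →-dec c ≟ᴮ true) ×-dec (a ≟ᴮ false →-dec b ≟ᴮ false →-dec c ≟ᴮ false)

movable? : ∀ r t → Dec (Movable r t)
movable? r t = t ≟ᴮ true →-dec endpoint r ≟ᴮ false

reorder-trans : ∀ r s w a b c t u v →
  Consistent r s a → Consistent s w b → Consistent r w c → TransitiveTriple a b c →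
  Movable r t → Movable s u → Movable w v →
  reorder r s a t u ≡ true → reorder s w b u v ≡ true → reorder r w c t v ≡ true
reorder-trans = toWitness {a? =
  ∀-Region? λ r → ∀-Region? λ s → ∀-Region? λ w → ∀-Bool? λ a → ∀-Bool? λ b → ∀-Bool? λ c →
  ∀-Bool? λ t → ∀-Bool? λ u → ∀-Bool? λ v →
  consistent? r s a →-dec consistent? s w b →-dec consistent? r w c →-dec transitive-triple? a b c →-dec
  movable? r t →-dec movable? s u →-dec movable? w v →-dec
  reorder r s a t u ≟ᴮ true →-dec reorder s w b u v ≟ᴮ true →-dec reorder r w c t v ≟ᴮ true} _

reorder-after-i : ∀ r a → Consistent at-i r a → Movable r true → reorder at-i r a false true ≡ true
reorder-after-i = toWitness {a? = ∀-Region? λ r → ∀-Bool? λ a →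
  consistent? at-i r a →-dec movable? r true →-dec reorder at-i r a false true ≟ᴮ true} _

reorder-before-j : ∀ r a → Consistent r at-j a → Movable r true → reorder r at-j a true false ≡ true
reorder-before-j = toWitness {a? = ∀-Region? λ r → ∀-Bool? λ a →
  consistent? r at-j a →-dec movable? r true →-dec reorder r at-j a true false ≟ᴮ true} _

module _ {V : Set} {α : Assignment V} where

  satisfies-pair : ∀ {v w b c} → α satisfies ((v , b) ∷ (w , c) ∷ []) → α v ≡ b ⊎ α w ≡ c
  satisfies-pair (here e)         = inj₁ e
  satisfies-pair (there (here e)) = inj₂ e

  satisfies-triple : ∀ {v w u b c d} → α satisfies ((v , b) ∷ (w , c) ∷ (u , d) ∷ []) → α v ≡ b ⊎ α w ≡ c ⊎ α u ≡ d
  satisfies-triple (here e)                 = inj₁ e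
  satisfies-triple (there (here e))         = inj₂ (inj₁ e)
  satisfies-triple (there (there (here e))) = inj₂ (inj₂ e)

resolve : ∀ {a} {B : Set} → a ≡ true → a ≡ false ⊎ B → B
resolve refl (inj₂ b) = b

exactly-one : ∀ {a b} → a ≡ false ⊎ b ≡ false → a ≡ true ⊎ b ≡ true → b ≡ not a
exactly-one {true}  {false} _ _ = refl
exactly-one {false} {true}  _ _ = refl
exactly-one {true}  {true}  (inj₁ ()) _
exactly-one {true}  {true}  (inj₂ ()) _
exactly-one {false} {false} _ (inj₁ ())
exactly-one {false} {false} _ (inj₂ ())

witness-source : ∀ e k a → a xor (e xor k) ≡ true → (k ≡ true → a ≡ true) → e ≡ true ⊎ a ≡ true
witness-source true  _     _     _  _   = inj₁ refl
witness-source false false true  _  _   = inj₂ refl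
witness-source false true  false _  k⇒a = inj₂ (k⇒a refl)
witness-source false true  true  () _
witness-source false false false () _

record IsWOrder {N : ℕ} (α : Assignment (Var N)) : Set where
  field
    x-flip    : ∀ {p q} → p ≢ q → α (x q p) ≡ not (α (x p q))
    x-trans   : ∀ {p q w} → p ≢ q → p ≢ w → q ≢ w → α (x p q) ≡ true → α (x q w) ≡ true → α (x p w) ≡ true
    z-witness : ∀ {a b c} → a ≢ b → a ≢ c → b ≢ c → α (z a b c) ≡ true → α (x a b) ≡ true × α (x b c) ≡ true

module _ {N : ℕ} {α : Assignment (Var N)} where

  proper⇒IsWOrder : Proper (WORDER N) α → IsWOrder α
  proper⇒IsWOrder proper = record
    { x-flip    = λ {p} {q} p≢q → exactly-one (satisfies-pair (proper _ (antisym p q p≢q)))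
                                              (satisfies-pair (proper _ (total p q p≢q)))
    ; x-trans   = λ p≢q p≢w q≢w pq qw → resolve qw (resolve pq (satisfies-triple (proper _ (WORDER.trans _ _ _ p≢q p≢w q≢w))))
    ; z-witness = λ a≢b a≢c b≢c za → resolve za (satisfies-pair (proper _ (wit₁ _ _ _ a≢b a≢c b≢c)))
                                   , resolve za (satisfies-pair (proper _ (wit₂ _ _ _ a≢b a≢c b≢c)))
    }

  IsWOrder⇒proper : IsWOrder α → Proper (WORDER N) α
  IsWOrder⇒proper wα _ (antisym p q p≢q) with α (x p q) in pq
  ... | false = here pq
  ... | true  = there (here (trans (IsWOrder.x-flip wα p≢q) (cong not pq)))
  IsWOrder⇒proper wα _ (total p q p≢q) with α (x p q) in pq
  ... | true  = here pq
  ... | false = there (here (trans (IsWOrder.x-flip wα p≢q) (cong not pq)))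
  IsWOrder⇒proper wα _ (WORDER.trans p q w p≢q p≢w q≢w) with α (x p q) in pq | α (x q w) in qw
  ... | false | _     = here pq
  ... | true  | false = there (here qw)
  ... | true  | true  = there (there (here (IsWOrder.x-trans wα p≢q p≢w q≢w pq qw)))
  IsWOrder⇒proper wα _ (wit₁ a b c a≢b a≢c b≢c) with α (z a b c) in za
  ... | false = here za
  ... | true  = there (here (proj₁ (IsWOrder.z-witness wα a≢b a≢c b≢c za)))
  IsWOrder⇒proper wα _ (wit₂ a b c a≢b a≢c b≢c) with α (z a b c) in za
  ... | false = here za
  ... | true  = there (here (proj₂ (IsWOrder.z-witness wα a≢b a≢c b≢c za)))

-- Moving points into (i, j)

module Extension {N : ℕ} (S : System (Var N)) (i j : Fin N) (i≢j : i ≢ j) where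

  Triple : Set
  Triple = Fin N × Fin N × Fin N

  Generator : Set
  Generator = Fin N ⊎ Triple

  _≟ᴳ_ : DecidableEquality Generator
  _≟ᴳ_ = ≡-dec⊎ _≟_ (≡-dec× _≟_ (≡-dec× _≟_ _≟_))

  open Coordinates _≟ᴳ_
  open import Data.List.Membership.DecPropositional (_≟_ {N}) using (_∉?_)

  allTriples : List Triple
  allTriples = cartesianProduct (allFin N) (cartesianProduct (allFin N) (allFin N))

  ∈-allTriples : (τ : Triple) → τ ∈ allTriples
  ∈-allTriples (a , b , c) = ∈-cartesianProduct⁺ (∈-allFin a) (∈-cartesianProduct⁺ (∈-allFin b) (∈-allFin c))

  unique-allTriples : Unique allTriples
  unique-allTriples = cartesianProduct⁺ (allFin⁺ N) (cartesianProduct⁺ (allFin⁺ N) (allFin⁺ N))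

  corners : Triple → List (Fin N)
  corners τ = proj₁ τ ∷ proj₁ (proj₂ τ) ∷ proj₂ (proj₂ τ) ∷ []

  length-concatMap-corners : (ts : List Triple) → length (concatMap corners ts) ≡ length ts * 3
  length-concatMap-corners []       = refl
  length-concatMap-corners (τ ∷ ts) = cong (3 +_) (length-concatMap-corners ts)

  zᵗ : Triple → Var N
  zᵗ (a , b , c) = z a b c

  entering-decompose : ∀ {m a c} → m ∧ (does (a ≟ i) ∧ does (c ≟ j)) ≡ true → m ≡ true × a ≡ i × c ≡ j
  entering-decompose {m} {a} {c} e with m | a ≟ i | c ≟ j | e
  ... | true  | yes a≡i | yes c≡j | _ = refl , a≡i , c≡j
  ... | false | _       | _       | ()
  ... | true  | no _    | _       | ()
  ... | true  | yes _   | no _    | ()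

  module Moves (α : Assignment (Var N)) where

    Active : Triple → Set
    Active τ = α (zᵗ τ) ≡ true

    active? : Decidable Active
    active? τ = α (zᵗ τ) ≟ᴮ true

    activeTriples : List Triple
    activeTriples = filter active? allTriples

    touched : List (Fin N)
    touched = i ∷ j ∷ concatMap corners activeTriples

    freePoints : List (Fin N)
    freePoints = filter (_∉? touched) (allFin N)

    generators : List Generator
    generators = map inj₁ freePoints ++ map inj₂ activeTriples

    region : Fin N → Region
    region p = if does (p ≟ i) then at-i else if does (p ≟ j) then at-j
               else if α (x p i) then before-i else if α (x j p) then after-j else between

    region-i : region i ≡ at-i
    region-i rewrite dec-true (i ≟ i) refl = refl

    region-j : region j ≡ at-j
    region-j rewrite dec-false (j ≟ i) (≢-sym i≢j) | dec-true (j ≟ j) refl = refl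

    crossing : Fin N → Fin N → Bool
    crossing p q = crosses (region p) (region q) (α (x p q))

    -- d_k flips x_pq for each pair of points that the move of k makes cross, and flips z_ikj; d_τ flips z_τ.
    direction : Generator → Var N → Bool
    direction g (x p q)   = (g ≡ᵇ inj₁ p ∧ crossing p q) xor (g ≡ᵇ inj₁ q ∧ crossing q p)
    direction g (z a b c) = (g ≡ᵇ inj₁ b ∧ (does (a ≟ i) ∧ does (c ≟ j))) xor (g ≡ᵇ inj₂ (a , b , c))

    shifted : (Generator → Bool) → Assignment (Var N)
    shifted σ v = α v xor xsum generators (λ g → σ g ∧ direction g v)

    rows : List (Generator → Bool)
    rows = map (λ e g → lhs (dloVars N) e (direction g)) S

    unique-generators : Unique generators
    unique-generators =
      ++⁺ (map⁺ inj₁-injective (filter⁺ (_∉? touched) (allFin⁺ N)))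
          (map⁺ inj₂-injective (filter⁺ active? unique-allTriples))
          disjoint
      where
        disjoint : ∀ {g} → ¬ (g ∈ map inj₁ freePoints × g ∈ map inj₂ activeTriples)
        disjoint (g∈₁ , g∈₂) with ∈-map⁻ inj₁ g∈₁ | ∈-map⁻ inj₂ g∈₂
        ... | _ , _ , refl | _ , _ , ()

    free⇒untouched : ∀ {k} → inj₁ k ∈ generators → k ∉ touched
    free⇒untouched k∈ with ∈-++⁻ (map inj₁ freePoints) k∈
    ... | inj₁ k∈₁ with _ , k∈free , refl ← ∈-map⁻ inj₁ k∈₁ = proj₂ (∈-filter⁻ (_∉? touched) {xs = allFin N} k∈free)
    ... | inj₂ k∈₂ with _ , _ , () ← ∈-map⁻ inj₂ k∈₂

    generator⇒active : ∀ {τ} → inj₂ τ ∈ generators → Active τ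
    generator⇒active τ∈ with ∈-++⁻ (map inj₁ freePoints) τ∈
    ... | inj₁ τ∈₁ with _ , _ , () ← ∈-map⁻ inj₁ τ∈₁
    ... | inj₂ τ∈₂ with _ , τ∈act , refl ← ∈-map⁻ inj₂ τ∈₂ = proj₂ (∈-filter⁻ active? {xs = allTriples} τ∈act)

    corner-touched : ∀ {τ p} → Active τ → p ∈ corners τ → p ∈ touched
    corner-touched act p∈ = there (there (∈-concat⁺′ p∈ (∈-map⁺ corners (∈-filter⁺ active? (∈-allTriples _) act))))

    many-generators : (N ∸ 3) / 3 ≤ length generators
    many-generators = subst ((N ∸ 3) / 3 ≤_) (sym length-generators) (third-bound N _ _ N≤)
      where
        length-generators : length generators ≡ length freePoints + length activeTriples
        length-generators = trans (length-++ (map inj₁ freePoints))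
                                  (cong₂ _+_ (length-map inj₁ freePoints) (length-map inj₂ activeTriples))
        N≤ : N ≤ length freePoints + (2 + length activeTriples * 3)
        N≤ = subst₂ _≤_ (length-tabulate id)
                        (cong (λ t → length freePoints + (2 + t)) (length-concatMap-corners activeTriples))
                        (length≤filter-∉+length _≟_ touched (allFin⁺ N))

    nontrivial-shift : length S < (N ∸ 3) / 3 → NontrivialSolution generators rows
    nontrivial-shift few = nontrivial-solution generators unique-generators rows
                   (<-≤-trans (subst (_< (N ∸ 3) / 3) (sym (length-map _ S)) few) many-generators)

    solves-shifted : ∀ {σ} → Solves (dloVars N) α S → All (λ ρ → dot generators σ ρ ≡ false) rows →
                     Solves (dloVars N) (shifted σ) S
    solves-shifted {σ} sα orthogonal = All.zipWith
      (λ { {e} (αe , σe) → trans (lhs-shift (dloVars N) e α generators σ direction) (trans (cong₂ _xor_ αe σe) (xor-identityʳ _)) })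
      (sα , map⁻ orthogonal)

  module Ordered {α : Assignment (Var N)} (wα : IsWOrder α) (αij : α (x i j) ≡ true) where
    open Moves α
    open IsWOrder wα

    data RegionView (p : Fin N) : Region → Set where
      before-i : p ≢ i → p ≢ j → α (x p i) ≡ true → RegionView p before-i
      at-i     : p ≡ i → RegionView p at-i
      between  : p ≢ i → p ≢ j → α (x p i) ≡ false → α (x j p) ≡ false → RegionView p between
      at-j     : p ≡ j → RegionView p at-j
      after-j  : p ≢ i → p ≢ j → α (x j p) ≡ true → RegionView p after-j

    region-view : ∀ p → RegionView p (region p)
    region-view p with p ≟ i
    ... | yes p≡i = at-i p≡i
    ... | no p≢i with p ≟ j
    ...   | yes p≡j = at-j p≡j
    ...   | no p≢j with α (x p i) in pi
    ...     | true = before-i p≢i p≢j pi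
    ...     | false with α (x j p) in jp
    ...       | true  = after-j p≢i p≢j jp
    ...       | false = between p≢i p≢j pi jp

    x-flip-false : ∀ {p q} → p ≢ q → α (x q p) ≡ false → α (x p q) ≡ true
    x-flip-false p≢q qp = trans (x-flip (≢-sym p≢q)) (cong not qp)

    precedes⇒x : ∀ {p q} → p ≢ q → region p ≺ region q → α (x p q) ≡ true
    precedes⇒x {p} {q} p≢q with region p | region-view p | region q | region-view q
    ... | before-i | before-i p≢i _ pi   | at-i    | at-i refl           = λ _ → pi
    ... | before-i | before-i p≢i _ pi   | between | between q≢i _ qi _  = λ _ → x-trans p≢i p≢q (≢-sym q≢i) pi (x-flip-false (≢-sym q≢i) qi)
    ... | before-i | before-i p≢i p≢j pi | at-j    | at-j refl           = λ _ → x-trans p≢i p≢j i≢j pi αij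
    ... | before-i | before-i p≢i p≢j pi | after-j | after-j _ q≢j jq    = λ _ → x-trans p≢j p≢q (≢-sym q≢j) (x-trans p≢i p≢j i≢j pi αij) jq
    ... | at-i     | at-i refl           | between | between q≢i _ qi _  = λ _ → x-flip-false (≢-sym q≢i) qi
    ... | at-i     | at-i refl           | at-j    | at-j refl           = λ _ → αij
    ... | at-i     | at-i refl           | after-j | after-j q≢i q≢j jq  = λ _ → x-trans i≢j (≢-sym q≢i) (≢-sym q≢j) αij jq
    ... | between  | between _ p≢j _ jp  | at-j    | at-j refl           = λ _ → x-flip-false p≢j jp
    ... | between  | between _ p≢j _ jp  | after-j | after-j _ q≢j jq    = λ _ → x-trans p≢j p≢q (≢-sym q≢j) (x-flip-false p≢j jp) jq
    ... | at-j     | at-j refl           | after-j | after-j _ _ jq      = λ _ → jq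
    ... | _        | _ | before-i | _ = λ ()
    ... | at-i     | _ | at-i     | _ = λ ()
    ... | between  | _ | at-i     | _ = λ ()
    ... | between  | _ | between  | _ = λ ()
    ... | at-j     | _ | at-i     | _ = λ ()
    ... | at-j     | _ | between  | _ = λ ()
    ... | at-j     | _ | at-j     | _ = λ ()
    ... | after-j  | _ | at-i     | _ = λ ()
    ... | after-j  | _ | between  | _ = λ ()
    ... | after-j  | _ | at-j     | _ = λ ()
    ... | after-j  | _ | after-j  | _ = λ ()

    consistent : ∀ {p q} → p ≢ q → Consistent (region p) (region q) (α (x p q))
    consistent p≢q = precedes⇒x p≢q , λ q≺p → trans (x-flip (≢-sym p≢q)) (cong not (precedes⇒x (≢-sym p≢q) q≺p))

    transitive-triple : ∀ {p q w} → p ≢ q → p ≢ w → q ≢ w → TransitiveTriple (α (x p q)) (α (x q w)) (α (x p w))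
    transitive-triple p≢q p≢w q≢w =
        x-trans p≢q p≢w q≢w
      , λ pq qw → trans (x-flip (≢-sym p≢w))
                        (cong not (x-trans (≢-sym q≢w) (≢-sym p≢w) (≢-sym p≢q) (x-flip-false (≢-sym q≢w) qw) (x-flip-false (≢-sym p≢q) pq)))

    module Shift {σ : Generator → Bool} (support : ∀ {g} → σ g ≡ true → g ∈ generators) where

      moved : Fin N → Bool
      moved p = σ (inj₁ p)

      killed : Triple → Bool
      killed τ = σ (inj₂ τ)

      private
        indicator-off : ∀ {g g₀ : Generator} (A : Bool) → g ≢ g₀ → g ≡ᵇ g₀ ∧ A ≡ false
        indicator-off A g≢g₀ = cong (_∧ A) (≡ᵇ-≢ g≢g₀)

      shifted-x : ∀ {p q} → shifted σ (x p q) ≡ α (x p q) xor ((moved p ∧ crossing p q) xor (moved q ∧ crossing q p))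
      shifted-x {p} {q} = cong (α (x p q) xor_) (begin
        xsum generators (λ g → σ g ∧ direction g (x p q))
          ≡⟨ xsum-two-points generators unique-generators support (inj₁ p) (inj₁ q) (indicator-off _) (indicator-off _) ⟩
        (moved p ∧ (inj₁ p ≡ᵇ inj₁ p ∧ crossing p q)) xor (moved q ∧ (inj₁ q ≡ᵇ inj₁ q ∧ crossing q p))
          ≡⟨ cong₂ (λ s t → (moved p ∧ (s ∧ crossing p q)) xor (moved q ∧ (t ∧ crossing q p))) (≡ᵇ-refl (inj₁ p)) (≡ᵇ-refl (inj₁ q)) ⟩
        (moved p ∧ crossing p q) xor (moved q ∧ crossing q p) ∎)
        where open ≡-Reasoning

      shifted-z : ∀ {a b c} → shifted σ (z a b c) ≡ α (z a b c) xor ((moved b ∧ (does (a ≟ i) ∧ does (c ≟ j))) xor killed (a , b , c))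
      shifted-z {a} {b} {c} = cong (α (z a b c) xor_) (begin
        xsum generators (λ g → σ g ∧ direction g (z a b c))
          ≡⟨ xsum-two-points generators unique-generators support (inj₁ b) (inj₂ (a , b , c)) (indicator-off _) ≡ᵇ-≢ ⟩
        (moved b ∧ (inj₁ b ≡ᵇ inj₁ b ∧ A)) xor (killed (a , b , c) ∧ (inj₂ (a , b , c) ≡ᵇ inj₂ (a , b , c)))
          ≡⟨ cong₂ (λ s t → (moved b ∧ (s ∧ A)) xor (killed (a , b , c) ∧ t)) (≡ᵇ-refl (inj₁ b)) (≡ᵇ-refl (inj₂ (a , b , c))) ⟩
        (moved b ∧ A) xor (killed (a , b , c) ∧ true)
          ≡⟨ cong ((moved b ∧ A) xor_) (∧-identityʳ _) ⟩
        (moved b ∧ A) xor killed (a , b , c) ∎)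
        where
          open ≡-Reasoning
          A = does (a ≟ i) ∧ does (c ≟ j)

      moved⇒untouched : ∀ {p} → moved p ≡ true → p ∉ touched
      moved⇒untouched mp = free⇒untouched (support mp)

      moved⇒≢i : ∀ {p} → moved p ≡ true → p ≢ i
      moved⇒≢i mp p≡i = moved⇒untouched mp (here p≡i)

      moved⇒≢j : ∀ {p} → moved p ≡ true → p ≢ j
      moved⇒≢j mp p≡j = moved⇒untouched mp (there (here p≡j))

      corner-unmoved : ∀ {τ p} → Active τ → p ∈ corners τ → moved p ≡ false
      corner-unmoved act p∈ = ¬-not (λ mp → moved⇒untouched mp (corner-touched act p∈))

      killed⇒active : ∀ {τ} → killed τ ≡ true → Active τ
      killed⇒active kτ = generator⇒active (support kτ)

      movable : ∀ p → Movable (region p) (moved p)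
      movable p mp with region p | region-view p
      ... | before-i | _        = refl
      ... | at-i     | at-i p≡i = ⊥-elim (moved⇒≢i mp p≡i)
      ... | between  | _        = refl
      ... | at-j     | at-j p≡j = ⊥-elim (moved⇒≢j mp p≡j)
      ... | after-j  | _        = refl

      unmoved-x : ∀ {p q} → moved p ≡ false → moved q ≡ false → shifted σ (x p q) ≡ α (x p q)
      unmoved-x {p} {q} mp mq = trans shifted-x (trans (cong₂ (λ s t → α (x p q) xor ((s ∧ crossing p q) xor (t ∧ crossing q p))) mp mq)
                                                       (xor-identityʳ _))

      shifted-reorder : ∀ {p q} → p ≢ q → shifted σ (x p q) ≡ reorder (region p) (region q) (α (x p q)) (moved p) (moved q)
      shifted-reorder {p} {q} p≢q =
        trans shifted-x (cong (λ a → α (x p q) xor ((moved p ∧ crossing p q) xor (moved q ∧ crosses (region q) (region p) a))) (x-flip p≢q))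

      unmoved-i : moved i ≡ false
      unmoved-i = ¬-not (λ mi → moved⇒≢i mi refl)

      unmoved-j : moved j ≡ false
      unmoved-j = ¬-not (λ mj → moved⇒≢j mj refl)

      enter-after-i : ∀ {b} → moved b ≡ true → shifted σ (x i b) ≡ true
      enter-after-i {b} mb = begin
        shifted σ (x i b)                                              ≡⟨ shifted-reorder i≢b ⟩
        reorder (region i) (region b) (α (x i b)) (moved i) (moved b)  ≡⟨ cong₂ (λ r t → reorder r (region b) (α (x i b)) t (moved b)) region-i unmoved-i ⟩
        reorder at-i (region b) (α (x i b)) false (moved b)            ≡⟨ cong (reorder at-i (region b) (α (x i b)) false) mb ⟩
        reorder at-i (region b) (α (x i b)) false true                 ≡⟨ reorder-after-i (region b) (α (x i b))
                                                                            (subst (λ r → Consistent r (region b) (α (x i b))) region-i (consistent i≢b))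
                                                                            (subst (Movable (region b)) mb (movable b)) ⟩
        true                                                           ∎
        where
          open ≡-Reasoning
          i≢b = ≢-sym (moved⇒≢i mb)

      enter-before-j : ∀ {b} → moved b ≡ true → shifted σ (x b j) ≡ true
      enter-before-j {b} mb = begin
        shifted σ (x b j)                                              ≡⟨ shifted-reorder b≢j ⟩
        reorder (region b) (region j) (α (x b j)) (moved b) (moved j)  ≡⟨ cong₂ (λ r t → reorder (region b) r (α (x b j)) (moved b) t) region-j unmoved-j ⟩
        reorder (region b) at-j (α (x b j)) (moved b) false            ≡⟨ cong (λ t → reorder (region b) at-j (α (x b j)) t false) mb ⟩
        reorder (region b) at-j (α (x b j)) true false                 ≡⟨ reorder-before-j (region b) (α (x b j))
                                                                            (subst (λ r → Consistent (region b) r (α (x b j))) region-j (consistent b≢j))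
                                                                            (subst (Movable (region b)) mb (movable b)) ⟩
        true                                                           ∎
        where
          open ≡-Reasoning
          b≢j = moved⇒≢j mb

      shifted-witness : ∀ {a b c} → a ≢ b → a ≢ c → b ≢ c → shifted σ (z a b c) ≡ true →
                        shifted σ (x a b) ≡ true × shifted σ (x b c) ≡ true
      shifted-witness {a} {b} {c} a≢b a≢c b≢c sz with witness-source (moved b ∧ (does (a ≟ i) ∧ does (c ≟ j))) (killed (a , b , c)) (α (z a b c))
                                                  (trans (sym shifted-z) sz) killed⇒active
      ... | inj₁ entering with mb , refl , refl ← entering-decompose {moved b} {a} {c} entering = enter-after-i mb , enter-before-j mb
      ... | inj₂ za =
          trans (unmoved-x (corner-unmoved za (here refl)) (corner-unmoved za (there (here refl)))) (proj₁ (z-witness a≢b a≢c b≢c za))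
        , trans (unmoved-x (corner-unmoved za (there (here refl))) (corner-unmoved za (there (there (here refl))))) (proj₂ (z-witness a≢b a≢c b≢c za))

      shifted-IsWOrder : IsWOrder (shifted σ)
      shifted-IsWOrder = record
        { x-flip    = λ {p} {q} p≢q → begin
            shifted σ (x q p)                                                      ≡⟨ shifted-x ⟩
            α (x q p) xor ((moved q ∧ crossing q p) xor (moved p ∧ crossing p q))  ≡⟨ cong₂ _xor_ (x-flip p≢q) (xor-comm (moved q ∧ crossing q p) _) ⟩
            not (α (x p q)) xor ((moved p ∧ crossing p q) xor (moved q ∧ crossing q p)) ≡⟨ not-distribˡ-xor (α (x p q)) _ ⟨
            not (α (x p q) xor ((moved p ∧ crossing p q) xor (moved q ∧ crossing q p))) ≡⟨ cong not shifted-x ⟨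
            not (shifted σ (x p q))                                                ∎
        ; x-trans   = λ {p} {q} {w} p≢q p≢w q≢w pq qw → trans (shifted-reorder p≢w)
            (reorder-trans (region p) (region q) (region w) (α (x p q)) (α (x q w)) (α (x p w)) (moved p) (moved q) (moved w)
                           (consistent p≢q) (consistent q≢w) (consistent p≢w) (transitive-triple p≢q p≢w q≢w)
                           (movable p) (movable q) (movable w)
                           (trans (sym (shifted-reorder p≢q)) pq) (trans (sym (shifted-reorder q≢w)) qw))
        ; z-witness = shifted-witness
        }
        where open ≡-Reasoning

      shifted-density : ∀ {k} → moved k ≡ true → shifted σ satisfies density i j
      shifted-density {k} mk = there (Any.map⁺ (lose k∈others shifted-zikj))
        where
          k∈others : k ∈ others i j
          k∈others = ∈-filter⁺ (λ k → ¬? (k ≟ i) ×-dec ¬? (k ≟ j)) (∈-allFin k) (moved⇒≢i mk , moved⇒≢j mk)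
          inactive : α (z i k j) ≡ false
          inactive = ¬-not (λ act → moved⇒untouched mk (corner-touched act (there (here refl))))
          not-killed : killed (i , k , j) ≡ false
          not-killed = ¬-not (λ kd → contradiction (trans (sym (killed⇒active kd)) inactive) λ ())
          shifted-zikj : shifted σ (z i k j) ≡ true
          shifted-zikj rewrite shifted-z {i} {k} {j} | inactive | mk | not-killed | dec-true (i ≟ i) refl | dec-true (j ≟ j) refl = refl

      module NoPointMoved (unmoved : ∀ p → moved p ≡ false) where

        shifted-ij : shifted σ (x i j) ≡ true
        shifted-ij = trans (unmoved-x (unmoved i) (unmoved j)) αij

        shifted-zᵗ : ∀ τ → shifted σ (zᵗ τ) ≡ α (zᵗ τ) xor killed τ
        shifted-zᵗ (a , b , c) = trans shifted-z (cong (λ m → α (z a b c) xor ((m ∧ (does (a ≟ i) ∧ does (c ≟ j))) xor killed (a , b , c))) (unmoved b))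

        still-active : ∀ {τ} → Moves.Active (shifted σ) τ → Active τ
        still-active {τ} act with killed τ in kτ
        ... | true  = killed⇒active kτ
        ... | false = begin
          α (zᵗ τ)                    ≡⟨ xor-identityʳ _ ⟨
          α (zᵗ τ) xor false          ≡⟨ cong (α (zᵗ τ) xor_) kτ ⟨
          α (zᵗ τ) xor killed τ       ≡⟨ shifted-zᵗ τ ⟨
          shifted σ (zᵗ τ)            ≡⟨ act ⟩
          true                        ∎
          where open ≡-Reasoning

        killed-inactive : ∀ {τ} → killed τ ≡ true → ¬ Moves.Active (shifted σ) τ
        killed-inactive {τ} kτ act with trans (sym (shifted-zᵗ τ)) act
        ... | e rewrite killed⇒active kτ | kτ = contradiction e λ ()

        fewer-active : ∀ {τ} → killed τ ≡ true → length (Moves.activeTriples (shifted σ)) < length activeTriples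
        fewer-active {τ} kτ = length-filter-< (Moves.active? (shifted σ)) active? still-active allTriples (∈-allTriples τ) (killed⇒active kτ) (killed-inactive kτ)

  Repair : (Assignment (Var N) → Set) → Set
  Repair P = ∃[ β ] P β × Solves (dloVars N) β S × β satisfies density i j

  Step : Assignment (Var N) → Set
  Step α = ∃[ β ] IsWOrder β × Solves (dloVars N) β S ×
           (β satisfies density i j ⊎ β (x i j) ≡ true × length (Moves.activeTriples β) < length (Moves.activeTriples α))

  step : length S < (N ∸ 3) / 3 → ∀ {α} → IsWOrder α → α (x i j) ≡ true → Solves (dloVars N) α S → Step α
  step few {α} wα αij sα = from-solution (Moves.nontrivial-shift α few)
    where
      open Moves α
      open Ordered wα αij
      from-solution : NontrivialSolution generators rows → Step α
      from-solution (σ , support , (g₀ , σg₀) , orthogonal) = by-moved (any? (λ k → σ (inj₁ k) ≟ᴮ true)) g₀ σg₀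
        where
          open Shift support
          by-moved : Dec (∃[ k ] moved k ≡ true) → (g : Generator) → σ g ≡ true → Step α
          by-moved (yes (k , mk)) _ _ = shifted σ , shifted-IsWOrder , solves-shifted {σ} sα orthogonal , inj₁ (shifted-density mk)
          by-moved (no none) (inj₁ k) σk = contradiction (k , σk) none
          by-moved (no none) (inj₂ τ) kτ = shifted σ , shifted-IsWOrder , solves-shifted {σ} sα orthogonal , inj₂ (shifted-ij , fewer-active kτ)
            where open NoPointMoved (λ p → ¬-not λ mp → none (p , mp))

  extend : length S < (N ∸ 3) / 3 → ∀ {α} → Acc _<_ (length (Moves.activeTriples α)) →
           IsWOrder α → α (x i j) ≡ true → Solves (dloVars N) α S → Repair IsWOrder
  extend few {α} (acc smaller) wα αij sα = continue (step few wα αij sα)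
    where
      continue : Step α → Repair IsWOrder
      continue (β , wβ , sβ , inj₁ dβ)            = β , wβ , sβ , dβ
      continue (β , wβ , sβ , inj₂ (βij , fewer)) = extend few (smaller fewer) wβ βij sβ

  repair : length S < (N ∸ 3) / 3 → ∀ {α} → Proper (WORDER N) α → Solves (dloVars N) α S → α (x i j) ≡ true →
           Repair (Proper (WORDER N))
  repair few pα sα αij = proper (extend few (<-wellFounded _) (proper⇒IsWOrder pα) αij sα)
    where
      proper : Repair IsWOrder → Repair (Proper (WORDER N))
      proper (β , wβ , sβ , dβ) = β , IsWOrder⇒proper wβ , sβ , dβ

lemma3p7 : (n : ℕ) → Extensible (dloVars (suc n)) (DLO (suc n)) (WORDER (suc n)) ((suc n ∸ 3) / 3)
lemma3p7 n S few (α , pα , sα) _ (worder C) ¬C = contradiction C ¬C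
lemma3p7 n S few (α , pα , sα) _ (dens i j i≢j) _ with α (x i j) in αij
... | false = α , pα , sα , here αij
... | true  = Extension.repair S i j i≢j few pα sα αij
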